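{- If $(\mathbf{H}, \mathrm{II}_{\mathbf{H}})$ is a Kleene UTP theory, then $(\{P \mid \mathbf{H}(P)=P\}, \sqcap, \top_{\mathbf{H}}, \mathbin{;}, \mathrm{II}_{\mathbf{H}}, \star_{\mathbf{H}})$ forms a weak Kleene algebra.
   Context: UTP relations are ordered by refinement $\sqsubseteq$ (universally closed reverse implication); nondeterministic choice is disjunction, $P \sqcap Q = P \lor Q$, with indexed form $\bigvee_{i\in I} P(i)$; $\mathbin{;}$ is relational (sequential) composition. A healthiness condition $\mathbf{H}$ is continuous if $\mathbf{H}(\bigvee_{i\in I} P(i)) = \bigvee_{i\in I}\mathbf{H}(P(i))$ for every non-empty $I$. A Kleene UTP theory $(\mathbf{H}, \mathrm{II}_{\mathbf{H}})$ satisfies: (1) $\mathbf{H}$ is idempotent and continuous; (2) the set of $\mathbf{H}$-healthy relations is closed under $\mathbin{;}$; (3) $\mathrm{II}_{\mathbf{H}}$ is $\mathbf{H}$-healthy; (4) $\mathrm{II}_{\mathbf{H}} \mathbin{;} P = P \mathbin{;} \mathrm{II}_{\mathbf{H}} = P$ for $\mathbf{H}$-healthy $P$; (5) $\top_{\mathbf{H}} \mathbin{;} P = \top_{\mathbf{H}}$ for $\mathbf{H}$-healthy $P$, where $\top_{\mathbf{H}} \triangleq \mathbf{H}(\mathit{false})$. Kleene plus is $P^{+} \triangleq \bigvee_{i\in\mathbb{N}} P^{i+1}$ (iterated sequential composition one or more times), and the theory star is $P^{\star_{\mathbf{H}}} \triangleq \mathrm{II}_{\mathbf{H}} \sqcap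 P^{+}$. A weak Kleene algebra $(K,+,0,\cdot,1,\star)$ is one where $(K,+,0)$ is an idempotent commutative monoid, $(K,\cdot,1)$ is a monoid, $\cdot$ distributes over $+$ on both sides, $0$ is a left annihilator of $\cdot$, and, with $x \le y \iff x+y=y$: $1 + x\cdot x^\star \le x^\star$; $z + x\cdot y \le y \implies x^\star\cdot z \le y$; $z + y\cdot x \le y \implies z \cdot x^\star \le y$. Here $+$ is $\sqcap$ and the order is $\sqsupseteq$. -}

module Defs where

open import Level using (Level; _⊔_) renaming (suc to lsuc; zero to lzero)
open import Data.Nat using (ℕ; zero; suc)
open import Data.Product using (Σ; _×_)
open import Data.Sum using (_⊎_)
open import Data.Empty using (⊥)
open import Relation.Binary.Structures using (IsEquivalence)

-- UTP (homogeneous) relations over a state space S: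
-- a relation is a predicate on the pair (undashed state, dashed state).

Rel : Set → Set₁
Rel S = S → S → Set

module _ {S : Set} where

  infix  4 _≈_ _⊑_
  infixr 6 _⊓_
  infixr 7 _⨾_

  _≈_ : Rel S → Rel S → Set
  P ≈ Q = ∀ s s' → (P s s' → Q s s') × (Q s s' → P s s')

  _⊑_ : Rel S → Rel S → Set
  P ⊑ Q = ∀ s s' → Q s s' → P s s'

  false : Rel S
  false s s' = ⊥

  _⊓_ : Rel S → Rel S → Rel S
  (P ⊓ Q) s s' = P s s' ⊎ Q s s'

  ⋁ : {I : Set} → (I → Rel S) → Rel S
  ⋁ {I} P s s' = Σ I (λ i → P i s s')

  _⨾_ : Rel S → Rel S → Rel S
  (P ⨾ Q) s s' = Σ S (λ m → P s m × Q m s')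

  -- pow1 P i = P^(i+1) = P ; P ; ... ; P  (i+1 copies)
  pow1 : Rel S → ℕ → Rel S
  pow1 P zero    = P
  pow1 P (suc i) = P ⨾ pow1 P i

  _⁺ : Rel S → Rel S
  P ⁺ = ⋁ (pow1 P)

  star : (II : Rel S) → Rel S → Rel S
  star II P = II ⊓ P ⁺

  Healthy : (Rel S → Rel S) → Rel S → Set
  Healthy H P = H P ≈ P

  ⊤[_] : (Rel S → Rel S) → Rel S
  ⊤[ H ] = H false

  record IsKleeneUTP (H : Rel S → Rel S) (II : Rel S) : Set₁ where
    field
      -- H is a function on predicates, hence respects their equality
      H-cong      : ∀ {P Q} → P ≈ Q → H P ≈ H Q
      H-idem      : ∀ P → H (H P) ≈ H P
      H-cont      : (I : Set) → I → (P : I → Rel S) →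
                    H (⋁ P) ≈ ⋁ (λ i → H (P i))
      ⨾-closed    : ∀ P Q → Healthy H P → Healthy H Q → Healthy H (P ⨾ Q)
      II-healthy  : Healthy H II
      II-unitˡ    : ∀ P → Healthy H P → (II ⨾ P) ≈ P
      II-unitʳ    : ∀ P → Healthy H P → (P ⨾ II) ≈ P
      ⊤-zeroˡ     : ∀ P → Healthy H P → (⊤[ H ] ⨾ P) ≈ ⊤[ H ]

-- Weak Kleene algebra on a subset C of a carrier A, with equality _≈_.
-- The operations are given on A; the subset must be closed under them
-- and the laws are required for elements of C.

record IsWeakKleeneAlgebraOn {a c e : Level} {A : Set a}
    (C : A → Set c) (_≈_ : A → A → Set e)
    (_+_ : A → A → A) (0# : A) (_·_ : A → A → A) (1# : A) (_⋆ : A → A)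
    : Set (a ⊔ c ⊔ e) where
  _≤_ : A → A → Set e
  x ≤ y = (x + y) ≈ y
  field
    +-closed : ∀ {x y} → C x → C y → C (x + y)
    0-closed : C 0#
    ·-closed : ∀ {x y} → C x → C y → C (x · y)
    1-closed : C 1#
    ⋆-closed : ∀ {x} → C x → C (x ⋆)
    ≈-equiv  : IsEquivalence _≈_
    +-cong   : ∀ {x x' y y'} → C x → C x' → C y → C y' →
               x ≈ x' → y ≈ y' → (x + y) ≈ (x' + y')
    ·-cong   : ∀ {x x' y y'} → C x → C x' → C y → C y' →
               x ≈ x' → y ≈ y' → (x · y) ≈ (x' · y')
    ⋆-cong   : ∀ {x x'} → C x → C x' → x ≈ x' → (x ⋆) ≈ (x' ⋆)
    +-assoc  : ∀ {x y z} → C x → C y → C z → ((x + y) + z) ≈ (x + (y + z))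
    +-comm   : ∀ {x y} → C x → C y → (x + y) ≈ (y + x)
    +-idem   : ∀ {x} → C x → (x + x) ≈ x
    +-identityˡ : ∀ {x} → C x → (0# + x) ≈ x
    +-identityʳ : ∀ {x} → C x → (x + 0#) ≈ x
    ·-assoc  : ∀ {x y z} → C x → C y → C z → ((x · y) · z) ≈ (x · (y · z))
    ·-identityˡ : ∀ {x} → C x → (1# · x) ≈ x
    ·-identityʳ : ∀ {x} → C x → (x · 1#) ≈ x
    distribˡ : ∀ {x y z} → C x → C y → C z → (x · (y + z)) ≈ ((x · y) + (x · z))
    distribʳ : ∀ {x y z} → C x → C y → C z → ((y + z) · x) ≈ ((y · x) + (z · x))
    zeroˡ    : ∀ {x} → C x → (0# · x) ≈ 0#
    ⋆-unfold : ∀ {x} → C x → (1# + (x · (x ⋆))) ≤ (x ⋆)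
    ⋆-indˡ   : ∀ {x y z} → C x → C y → C z → (z + (x · y)) ≤ y → ((x ⋆) · z) ≤ y
    ⋆-indʳ   : ∀ {x y z} → C x → C y → C z → (z + (y · x)) ≤ y → (z · (x ⋆)) ≤ y

module Submission where

-- Continuity of H over a two-element index set gives H (P ⊓ Q) ≈ H P ⊓ H Q, so healthy
-- relations are closed under choice and H is monotone; monotonicity makes ⊤_H = H false
-- the least healthy relation, i.e. the zero of ⊓. Continuity over ℕ makes P⁺ healthy.
-- Since P⁺ is literally the union of the powers of P, the induction axioms reduce to an
-- induction on the exponent, and II_H only enters through its unit laws.

open import Defs
open import Data.Nat using (ℕ; zero; suc)
open import Data.Product using (_,_; proj₁; proj₂)
open import Data.Sum using (inj₁; inj₂; [_,_])
open import Data.Bool using (Bool; true; if_then_else_) renaming (false to ff)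
open import Function using (id; _∘_)
open import Relation.Binary.Structures using (IsEquivalence)

module RelationLaws {S : Set} where

  ≈-refl : {P : Rel S} → P ≈ P
  ≈-refl s s' = id , id

  ≈-sym : {P Q : Rel S} → P ≈ Q → Q ≈ P
  ≈-sym e s s' = proj₂ (e s s') , proj₁ (e s s')

  ≈-trans : {P Q R : Rel S} → P ≈ Q → Q ≈ R → P ≈ R
  ≈-trans e f s s' = proj₁ (f s s') ∘ proj₁ (e s s') , proj₂ (e s s') ∘ proj₂ (f s s')

  ≈-isEquivalence : IsEquivalence (_≈_ {S})
  ≈-isEquivalence = record { refl = ≈-refl ; sym = ≈-sym ; trans = ≈-trans }

  ≈⇒⊑ : {P Q : Rel S} → P ≈ Q → Q ⊑ P
  ≈⇒⊑ e s s' = proj₁ (e s s')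

  ≈⇒⊒ : {P Q : Rel S} → P ≈ Q → P ⊑ Q
  ≈⇒⊒ e s s' = proj₂ (e s s')

  ⊑-trans : {P Q R : Rel S} → P ⊑ Q → Q ⊑ R → P ⊑ R
  ⊑-trans f g s s' = f s s' ∘ g s s'

  ⊑-antisym : {P Q : Rel S} → P ⊑ Q → Q ⊑ P → P ≈ Q
  ⊑-antisym f g s s' = g s s' , f s s'

  -- The Kleene-algebra order x ≤ y, i.e. x ⊓ y ≈ y, is reverse refinement.
  ⊑⇒⊓≈ : {P Q : Rel S} → Q ⊑ P → P ⊓ Q ≈ Q
  ⊑⇒⊓≈ f s s' = [ f s s' , id ] , inj₂

  ⊓≈⇒⊑ : {P Q : Rel S} → P ⊓ Q ≈ Q → Q ⊑ P
  ⊓≈⇒⊑ e s s' = proj₁ (e s s') ∘ inj₁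

  ⊓-⊑ˡ : {P Q : Rel S} → P ⊓ Q ⊑ P
  ⊓-⊑ˡ s s' = inj₁

  ⊓-⊑ʳ : {P Q : Rel S} → P ⊓ Q ⊑ Q
  ⊓-⊑ʳ s s' = inj₂

  ⊓-mono : {P P' Q Q' : Rel S} → P ⊑ P' → Q ⊑ Q' → P ⊓ Q ⊑ P' ⊓ Q'
  ⊓-mono f g s s' = [ inj₁ ∘ f s s' , inj₂ ∘ g s s' ]

  ⊓-cong : {P P' Q Q' : Rel S} → P ≈ P' → Q ≈ Q' → P ⊓ Q ≈ P' ⊓ Q'
  ⊓-cong e f = ⊑-antisym (⊓-mono (≈⇒⊒ e) (≈⇒⊒ f)) (⊓-mono (≈⇒⊑ e) (≈⇒⊑ f))

  ⊓-assoc : (P Q R : Rel S) → (P ⊓ Q) ⊓ R ≈ P ⊓ (Q ⊓ R)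
  ⊓-assoc P Q R s s' = [ [ inj₁ , inj₂ ∘ inj₁ ] , inj₂ ∘ inj₂ ]
                     , [ inj₁ ∘ inj₁ , [ inj₁ ∘ inj₂ , inj₂ ] ]

  ⊓-comm : (P Q : Rel S) → P ⊓ Q ≈ Q ⊓ P
  ⊓-comm P Q s s' = [ inj₂ , inj₁ ] , [ inj₂ , inj₁ ]

  ⊓-idem : (P : Rel S) → P ⊓ P ≈ P
  ⊓-idem P s s' = [ id , id ] , inj₁

  ⊓≈⋁-Bool : (F : Bool → Rel S) → F true ⊓ F ff ≈ ⋁ F
  ⊓≈⋁-Bool F s s' = [ (true ,_) , (ff ,_) ] , λ { (true , p) → inj₁ p ; (ff , q) → inj₂ q }

  ⋁-cong : {I : Set} {P Q : I → Rel S} → (∀ i → P i ≈ Q i) → ⋁ P ≈ ⋁ Q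
  ⋁-cong e s s' = (λ { (i , p) → i , proj₁ (e i s s') p })
                , (λ { (i , q) → i , proj₂ (e i s s') q })

  ⨾-mono : {P P' Q Q' : Rel S} → P ⊑ P' → Q ⊑ Q' → P ⨾ Q ⊑ P' ⨾ Q'
  ⨾-mono f g s s' (m , p , q) = m , f s m p , g m s' q

  ⨾-cong : {P P' Q Q' : Rel S} → P ≈ P' → Q ≈ Q' → P ⨾ Q ≈ P' ⨾ Q'
  ⨾-cong e f = ⊑-antisym (⨾-mono (≈⇒⊒ e) (≈⇒⊒ f)) (⨾-mono (≈⇒⊑ e) (≈⇒⊑ f))

  ⨾-assoc : (P Q R : Rel S) → (P ⨾ Q) ⨾ R ≈ P ⨾ (Q ⨾ R)
  ⨾-assoc P Q R s s' = (λ { (m , (k , p , q) , r) → k , p , m , q , r })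
                     , (λ { (k , p , m , q , r) → m , (k , p , q) , r })

  ⨾-distribˡ-⊓ : (P Q R : Rel S) → P ⨾ (Q ⊓ R) ≈ (P ⨾ Q) ⊓ (P ⨾ R)
  ⨾-distribˡ-⊓ P Q R s s' =
      (λ { (m , p , inj₁ q) → inj₁ (m , p , q) ; (m , p , inj₂ r) → inj₂ (m , p , r) })
    , [ (λ { (m , p , q) → m , p , inj₁ q }) , (λ { (m , p , r) → m , p , inj₂ r }) ]

  ⨾-distribʳ-⊓ : (P Q R : Rel S) → (Q ⊓ R) ⨾ P ≈ (Q ⨾ P) ⊓ (R ⨾ P)
  ⨾-distribʳ-⊓ P Q R s s' =
      (λ { (m , inj₁ q , p) → inj₁ (m , q , p) ; (m , inj₂ r , p) → inj₂ (m , r , p) })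
    , [ (λ { (m , q , p) → m , inj₁ q , p }) , (λ { (m , r , p) → m , inj₂ r , p }) ]

  pow1-cong : {P Q : Rel S} → P ≈ Q → ∀ i → pow1 P i ≈ pow1 Q i
  pow1-cong e zero    = e
  pow1-cong e (suc i) = ⨾-cong e (pow1-cong e i)

  ⁺-cong : {P Q : Rel S} → P ≈ Q → P ⁺ ≈ Q ⁺
  ⁺-cong e = ⋁-cong (pow1-cong e)

  ⁺-unfoldˡ : (P : Rel S) → P ⁺ ⊑ P ⨾ P ⁺
  ⁺-unfoldˡ P s s' (m , p , i , q) = suc i , m , p , q

  pow1-inductionˡ : {X Y : Rel S} → Y ⊑ X ⨾ Y → ∀ i → Y ⊑ pow1 X i ⨾ Y
  pow1-inductionˡ step zero    = step
  pow1-inductionˡ step (suc i) =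
    ⊑-trans step (⊑-trans (⨾-mono (λ _ _ → id) (pow1-inductionˡ step i))
                          (≈⇒⊑ (⨾-assoc _ _ _)))

  pow1-inductionʳ : {X Y : Rel S} → Y ⊑ Y ⨾ X → ∀ i → Y ⊑ Y ⨾ pow1 X i
  pow1-inductionʳ step zero    = step
  pow1-inductionʳ step (suc i) =
    ⊑-trans (pow1-inductionʳ step i)
            (⊑-trans (⨾-mono step (λ _ _ → id)) (≈⇒⊒ (⨾-assoc _ _ _)))

  ⁺-inductionˡ : {X Y : Rel S} → Y ⊑ X ⨾ Y → Y ⊑ X ⁺ ⨾ Y
  ⁺-inductionˡ step s s' (m , (i , x) , y) = pow1-inductionˡ step i s s' (m , x , y)

  ⁺-inductionʳ : {X Y : Rel S} → Y ⊑ Y ⨾ X → Y ⊑ Y ⨾ X ⁺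
  ⁺-inductionʳ step s s' (m , y , (i , x)) = pow1-inductionʳ step i s s' (m , y , x)

module KleeneUTPLaws {S : Set} {H : Rel S → Rel S} {II : Rel S} (K : IsKleeneUTP H II) where
  open RelationLaws
  open IsKleeneUTP K

  H-distrib-⊓ : (P Q : Rel S) → H (P ⊓ Q) ≈ H P ⊓ H Q
  H-distrib-⊓ P Q =
    ≈-trans (H-cong (⊓≈⋁-Bool choice))
            (≈-trans (H-cont Bool true choice) (≈-sym (⊓≈⋁-Bool (H ∘ choice))))
    where
    choice : Bool → Rel S
    choice b = if b then P else Q

  H-mono : {P Q : Rel S} → P ⊑ Q → H P ⊑ H Q
  H-mono {P} {Q} f =
    ⊑-trans (≈⇒⊑ (H-cong (⊑⇒⊓≈ f))) (⊑-trans (≈⇒⊒ (H-distrib-⊓ Q P)) ⊓-⊑ˡ)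

  ⊓-healthy : {P Q : Rel S} → Healthy H P → Healthy H Q → Healthy H (P ⊓ Q)
  ⊓-healthy {P} {Q} hP hQ = ≈-trans (H-distrib-⊓ P Q) (⊓-cong hP hQ)

  ⊤-healthy : Healthy H ⊤[ H ]
  ⊤-healthy = H-idem false

  ⊤-least : {P : Rel S} → Healthy H P → P ⊑ ⊤[ H ]
  ⊤-least hP = ⊑-trans (≈⇒⊑ hP) (H-mono (λ _ _ ()))

  pow1-healthy : {P : Rel S} → Healthy H P → ∀ i → Healthy H (pow1 P i)
  pow1-healthy hP zero    = hP
  pow1-healthy hP (suc i) = ⨾-closed _ _ hP (pow1-healthy hP i)

  ⁺-healthy : {P : Rel S} → Healthy H P → Healthy H (P ⁺)
  ⁺-healthy {P} hP = ≈-trans (H-cont ℕ zero (pow1 P)) (⋁-cong (pow1-healthy hP))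

  star-healthy : {P : Rel S} → Healthy H P → Healthy H (star II P)
  star-healthy hP = ⊓-healthy II-healthy (⁺-healthy hP)

  star-unfold : {P : Rel S} → Healthy H P → star II P ⊑ II ⊓ P ⨾ star II P
  star-unfold hP s s' (inj₁ ii) = inj₁ ii
  star-unfold hP s s' (inj₂ (m , p , inj₁ ii)) = inj₂ (zero , ≈⇒⊑ (II-unitʳ _ hP) s s' (m , p , ii))
  star-unfold {P} hP s s' (inj₂ (m , p , inj₂ q)) = inj₂ (⁺-unfoldˡ P s s' (m , p , q))

  star-inductionˡ : {X Y Z : Rel S} → Healthy H Z →
                    Y ⊑ Z → Y ⊑ X ⨾ Y → Y ⊑ star II X ⨾ Z
  star-inductionˡ hZ YZ step s s' (m , inj₁ ii , z) = YZ s s' (≈⇒⊑ (II-unitˡ _ hZ) s s' (m , ii , z))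
  star-inductionˡ hZ YZ step s s' (m , inj₂ x , z) = ⁺-inductionˡ step s s' (m , x , YZ m s' z)

  star-inductionʳ : {X Y Z : Rel S} → Healthy H Z →
                    Y ⊑ Z → Y ⊑ Y ⨾ X → Y ⊑ Z ⨾ star II X
  star-inductionʳ hZ YZ step s s' (m , z , inj₁ ii) = YZ s s' (≈⇒⊑ (II-unitʳ _ hZ) s s' (m , z , ii))
  star-inductionʳ hZ YZ step s s' (m , z , inj₂ x) = ⁺-inductionʳ step s s' (m , YZ s m z , x)

theorem10 : {S : Set} (H : Rel S → Rel S) (II : Rel S) →
    IsKleeneUTP H II →
    IsWeakKleeneAlgebraOn (Healthy H) _≈_ _⊓_ ⊤[ H ] _⨾_ II (star II)
theorem10 H II K = record
  { +-closed    = ⊓-healthy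
  ; 0-closed    = ⊤-healthy
  ; ·-closed    = ⨾-closed _ _
  ; 1-closed    = II-healthy
  ; ⋆-closed    = star-healthy
  ; ≈-equiv     = ≈-isEquivalence
  ; +-cong      = λ _ _ _ _ → ⊓-cong
  ; ·-cong      = λ _ _ _ _ → ⨾-cong
  ; ⋆-cong      = λ _ _ e → ⊓-cong ≈-refl (⁺-cong e)
  ; +-assoc     = λ _ _ _ → ⊓-assoc _ _ _
  ; +-comm      = λ _ _ → ⊓-comm _ _
  ; +-idem      = λ _ → ⊓-idem _
  ; +-identityˡ = λ hP → ⊑⇒⊓≈ (⊤-least hP)
  ; +-identityʳ = λ hP → ≈-trans (⊓-comm _ _) (⊑⇒⊓≈ (⊤-least hP))
  ; ·-assoc     = λ _ _ _ → ⨾-assoc _ _ _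
  ; ·-identityˡ = II-unitˡ _
  ; ·-identityʳ = II-unitʳ _
  ; distribˡ    = λ _ _ _ → ⨾-distribˡ-⊓ _ _ _
  ; distribʳ    = λ _ _ _ → ⨾-distribʳ-⊓ _ _ _
  ; zeroˡ       = ⊤-zeroˡ _
  ; ⋆-unfold    = λ hP → ⊑⇒⊓≈ (star-unfold hP)
  ; ⋆-indˡ      = λ _ _ hZ le → ⊑⇒⊓≈ (starˡ hZ (⊓≈⇒⊑ le))
  ; ⋆-indʳ      = λ _ _ hZ le → ⊑⇒⊓≈ (starʳ hZ (⊓≈⇒⊑ le))
  }
  where
  open RelationLaws
  open IsKleeneUTP K
  open KleeneUTPLaws K
  starˡ : ∀ {X Y Z} → Healthy H Z → Y ⊑ Z ⊓ X ⨾ Y → Y ⊑ star II X ⨾ Z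
  starˡ hZ le = star-inductionˡ hZ (⊑-trans le ⊓-⊑ˡ) (⊑-trans le ⊓-⊑ʳ)
  starʳ : ∀ {X Y Z} → Healthy H Z → Y ⊑ Z ⊓ Y ⨾ X → Y ⊑ Z ⨾ star II X
  starʳ hZ le = star-inductionʳ hZ (⊑-trans le ⊓-⊑ˡ) (⊑-trans le ⊓-⊑ʳ)
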